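{- Let $H$ be a connected graph with at least one non-loop edge, and let $H^-$ be the graph obtained from $H$ by deleting exactly one non-loop edge (keeping all vertices). If $H^-$ is connected, then $\lambda_H(H^-)\neq0$.
   Context: Graphs are finite, undirected, possibly with loops; non-empty means at least one vertex. A subgraph $H'$ of $H$ is loop-hereditary if every vertex of $H'$ that has a loop in $H$ also has a loop in $H'$. For connected $H$, $\mathrm{Sub}(H)$ is the set of non-empty, loop-hereditary, connected subgraphs of $H$; $\mathcal{S}_H$ contains exactly one representative of each isomorphism class of graphs in $\mathrm{Sub}(H)$; for $H'\in\mathcal{S}_H$, $\mu_H(H')$ is the number of graphs in $\mathrm{Sub}(H)$ isomorphic to $H'$. For each non-empty connected graph $H$ a weight $\lambda_H(J)\in\mathbb{Z}$ is defined for every non-empty connected graph $J$ by: $\lambda_H(J)=0$ if $J$ is isomorphic to no graph in $\mathcal{S}_H$; $\lambda_H(J)=1$ if $J\cong H$; otherwise (inductively, on graphs smaller than $H$ in number of vertices, then number of edges) $\lambda_H(J)=-\sum_{H'\in\mathcal{S}_H,\ H'\not\cong H}\mu_H(H')\lambda_{H'}(J)$. -}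

module Defs where

open import Data.Nat using (ℕ; zero; suc)
open import Data.Fin using (Fin)
open import Data.Bool using (Bool; true; false)
open import Data.Integer using (ℤ; _+_; -_; 0ℤ)
open import Data.Vec.Functional using (Vector; _∷_)
open import Data.Product using (Σ; ∃; _×_; proj₁; proj₂)
open import Relation.Nullary using (¬_)
import Data.Sum
open import Relation.Binary.PropositionalEquality using (_≡_)

-- Finite graphs (possibly with loops), represented on the ambient
-- finite set Fin n by a vertex mask V and a symmetric adjacency E.
-- The vertex set of the graph is { i | V i ≡ true }; E i i ≡ true is a
-- loop at i.  Subgraphs of a graph on Fin n are again graphs on Fin n.

record Graph (n : ℕ) : Set where
  constructor mkGraph
  field
    V     : Fin n → Bool
    E     : Fin n → Fin n → Bool
    E-sym : ∀ i j → E i j ≡ E j i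
    E-V   : ∀ i j → E i j ≡ true → V i ≡ true

open Graph public

Vert : ∀ {n} → Graph n → Set
Vert {n} G = Σ (Fin n) λ i → V G i ≡ true

data Walk {n} (G : Graph n) : Fin n → Fin n → Set where
  here : ∀ {i} → Walk G i i
  step : ∀ {i j k} → E G i j ≡ true → Walk G j k → Walk G i k

Connected : ∀ {n} → Graph n → Set
Connected {n} G =
  (∃ λ (i : Fin n) → V G i ≡ true) ×
  (∀ i j → V G i ≡ true → V G j ≡ true → Walk G i j)

record _≅_ {n m} (G : Graph n) (K : Graph m) : Set where
  field
    to      : Vert G → Vert K
    from    : Vert K → Vert G
    from-to : ∀ x → proj₁ (from (to x)) ≡ proj₁ x
    to-from : ∀ y → proj₁ (to (from y)) ≡ proj₁ y
    adj     : ∀ x y → E G (proj₁ x) (proj₁ y) ≡ E K (proj₁ (to x)) (proj₁ (to y))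

record InSub {n} (H G : Graph n) : Set where
  field
    V-sub  : ∀ i → V G i ≡ true → V H i ≡ true
    E-sub  : ∀ i j → E G i j ≡ true → E H i j ≡ true
    loop-h : ∀ i → V G i ≡ true → E H i i ≡ true → E G i i ≡ true
    conn   : Connected G

record ProperSub {n} (H : Graph n) (V' : Fin n → Bool) (E' : Fin n → Fin n → Bool) : Set where
  field
    sym'   : ∀ i j → E' i j ≡ E' j i
    EV'    : ∀ i j → E' i j ≡ true → V' i ≡ true
    insub  : InSub H (mkGraph V' E' sym' EV')
    not≅H  : ¬ (mkGraph V' E' sym' EV' ≅ H)

asGraph : ∀ {n} {H : Graph n} {V' E'} → ProperSub H V' E' → Graph n
asGraph {V' = V'} {E'} p = mkGraph V' E' (ProperSub.sym' p) (ProperSub.EV' p)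

-- Finite sums over all functions Fin k → A (each function listed once,
-- up to pointwise equality), given a summation over A.

sumVec : ∀ {A : Set} (k : ℕ) → ((A → ℤ) → ℤ) → ((Fin k → A) → ℤ) → ℤ
sumVec zero    s f = f (λ ())
sumVec (suc k) s f = s (λ a → sumVec k s (λ g → f (a ∷ g)))

sumBool : (Bool → ℤ) → ℤ
sumBool f = f false + f true

sumVE : (n : ℕ) → ((Fin n → Bool) → (Fin n → Fin n → Bool) → ℤ) → ℤ
sumVE n z = sumVec n sumBool (λ V' → sumVec n (sumVec n sumBool) (λ E' → z V' E'))

-- λ_H(J) ≡ c, as an inductive relation  Lam J H c.
-- The sum  Σ_{H' ∈ S_H, H' ≇ H} μ_H(H') λ_{H'}(J)  is written as the sum
-- over all members G of Sub(H) with G ≇ H of λ_G(J); members of Sub(H)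
-- are exactly the raw pairs (V,E) satisfying ProperSub, all others get
-- weight 0.

data Lam {m} (J : Graph m) : ∀ {n} → Graph n → ℤ → Set where
  lam-zero : ∀ {n} {H : Graph n} →
             ¬ (∃ λ (G : Graph n) → InSub H G × (G ≅ J)) →
             Lam J H 0ℤ
  lam-one  : ∀ {n} {H : Graph n} → J ≅ H → Lam J H (Data.Integer.+ 1)
  lam-rec  : ∀ {n} {H : Graph n} →
             (∃ λ (G : Graph n) → InSub H G × (G ≅ J)) →
             ¬ (J ≅ H) →
             (z : (Fin n → Bool) → (Fin n → Fin n → Bool) → ℤ) →
             (∀ V' E' → (p : ProperSub H V' E') → Lam J (asGraph p) (z V' E')) →
             (∀ V' E' → ¬ ProperSub H V' E' → z V' E' ≡ 0ℤ) →
             Lam J H (- sumVE n z)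

record DeleteEdge {n} (H H⁻ : Graph n) (u v : Fin n) : Set where
  field
    same-V   : ∀ i → V H⁻ i ≡ V H i
    gone     : E H⁻ u v ≡ false
    kept     : ∀ i j → ¬ ((i ≡ u × j ≡ v) Data.Sum.⊎ (i ≡ v × j ≡ u)) → E H⁻ i j ≡ E H i j

-- A member G of Sub(H) other than H that contains a copy of H⁻ is itself a copy
-- of H⁻: counting shows that it has all vertices of H, and an edge of G outside
-- the copy would give G at least as many edges as H, forcing G = H.  So λ_G(H⁻)
-- is 1 on the copies of H⁻ in Sub(H) and 0 on every other proper member, and
-- λ_H(H⁻) is minus the number of copies of H⁻ in Sub(H), which is at least one.
-- Computing the weights requires deciding graph isomorphism, done by exhaustive
-- search over vertex maps.
{-# OPTIONS --safe #-}
module Submission where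

open import Defs
open import Data.Nat using (ℕ)
open import Data.Fin using (Fin)
open import Data.Bool using (true)
open import Data.Integer using (ℤ; 0ℤ)
open import Data.Product using (∃; _×_)
open import Relation.Nullary using (¬_)
open import Relation.Binary.PropositionalEquality using (_≡_)

open import Data.Nat using (zero; suc; _+_; _*_; _≤_; z≤n; s≤s)
import Data.Nat.Properties as ℕ
open import Data.Fin using (zero; suc; combine; remQuot)
open import Data.Fin.Properties
  using (_≟_; suc-injective; any?; all?; remQuot-combine; combine-remQuot; combine-injective)
open import Data.Bool using (Bool; false; not; _∧_; if_then_else_)
import Data.Bool.Properties as Bool
open import Data.Integer using (1ℤ; -_; +≤+)
import Data.Integer as ℤ
open import Data.Integer.Properties using (+-mono-≤; +-identityˡ; +-identityʳ; ≤-reflexive; _≤?_)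
open import Data.Product using (Σ; _,_; proj₁; proj₂)
open import Data.Sum using (_⊎_; inj₁; inj₂)
open import Data.Vec.Functional using (_∷_)
open import Data.Vec.Functional.Relation.Binary.Pointwise using (Pointwise)
open import Function using (_∘_; case_of_; mk⇔)
open import Axiom.UniquenessOfIdentityProofs using (module Decidable⇒UIP)
open import Relation.Nullary using (Dec; yes; no; does; contradiction)
open import Relation.Nullary.Decidable using (dec-false; _→-dec_; _×-dec_; _⊎-dec_; map′)
open import Relation.Binary.PropositionalEquality
  using (refl; sym; trans; cong; cong₂; subst; subst₂; _≢_; _≗_; module ≡-Reasoning)

-- Finite sets as Boolean predicates on Fin k

count : ∀ {k} → (Fin k → Bool) → ℕ
count {zero}  P = 0
count {suc k} P = if P zero then suc (count (P ∘ suc)) else count (P ∘ suc)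

_⊆_ : ∀ {k} → (Fin k → Bool) → (Fin k → Bool) → Set
P ⊆ Q = ∀ i → P i ≡ true → Q i ≡ true

-- `not (P i)` comes first so that the difference reduces as soon as `P i` is known.
_─_ : ∀ {k} → (Fin k → Bool) → (Fin k → Bool) → Fin k → Bool
(Q ─ P) i = not (P i) ∧ Q i

⁅_⁆ : ∀ {k} → Fin k → Fin k → Bool
⁅ j ⁆ i = does (i ≟ j)

count-─⁅⁆ : ∀ {k} (Q : Fin k → Bool) j → Q j ≡ true → count Q ≡ suc (count (Q ─ ⁅ j ⁆))
count-─⁅⁆ Q zero    Qj rewrite Qj = refl
count-─⁅⁆ Q (suc j) Qj with Q zero
... | true  = cong suc (count-─⁅⁆ (Q ∘ suc) j Qj)
... | false = count-─⁅⁆ (Q ∘ suc) j Qj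

∈-─ : ∀ {k} {P Q : Fin k → Bool} {i} → Q i ≡ true → P i ≡ false → (Q ─ P) i ≡ true
∈-─ Qi Pi rewrite Pi = Qi

∈-─⁅⁆ : ∀ {k} {Q : Fin k → Bool} {i j} → Q i ≡ true → i ≢ j → (Q ─ ⁅ j ⁆) i ≡ true
∈-─⁅⁆ {Q = Q} {i} {j} Qi i≢j = ∈-─ {P = ⁅ j ⁆} {Q} Qi (dec-false (i ≟ j) i≢j)

InjectiveOn : ∀ {k m} → (Fin k → Bool) → (Fin k → Fin m) → Set
InjectiveOn P f = ∀ i j → P i ≡ true → P j ≡ true → f i ≡ f j → i ≡ j

injection⇒count≤ : ∀ {k m} {P : Fin k → Bool} {Q : Fin m → Bool} (f : Fin k → Fin m) →
  (∀ i → P i ≡ true → Q (f i) ≡ true) → InjectiveOn P f → count P ≤ count Q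
injection⇒count≤ {zero}  f into inj = z≤n
injection⇒count≤ {suc k} {P = P} {Q} f into inj with P zero in P₀
... | false = injection⇒count≤ (f ∘ suc) (into ∘ suc) (λ i j Pi Pj → suc-injective ∘ inj _ _ Pi Pj)
... | true  = subst (suc (count (P ∘ suc)) ≤_) (sym (count-─⁅⁆ Q (f zero) (into zero P₀)))
                (s≤s (injection⇒count≤ (f ∘ suc) into-rest (λ i j Pi Pj → suc-injective ∘ inj _ _ Pi Pj)))
  where
  into-rest : ∀ i → P (suc i) ≡ true → (Q ─ ⁅ f zero ⁆) (f (suc i)) ≡ true
  into-rest i Pi = ∈-─⁅⁆ {Q = Q} (into (suc i) Pi) λ fi≡f₀ → case inj (suc i) zero Pi P₀ fi≡f₀ of λ ()

count-─ : ∀ {k} {P Q : Fin k → Bool} → P ⊆ Q → count Q ≡ count P + count (Q ─ P)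
count-─ {zero} P⊆Q = refl
count-─ {suc k} {P} {Q} P⊆Q with P zero in P₀ | Q zero in Q₀
... | true  | true  = cong suc (count-─ (P⊆Q ∘ suc))
... | true  | false = contradiction (trans (sym (P⊆Q zero P₀)) Q₀) λ ()
... | false | true  = trans (cong suc (count-─ (P⊆Q ∘ suc))) (sym (ℕ.+-suc _ _))
... | false | false = count-─ (P⊆Q ∘ suc)

∈-─⇒∈×∉ : ∀ {k} {P Q : Fin k → Bool} {i} → (Q ─ P) i ≡ true → Q i ≡ true × P i ≡ false
∈-─⇒∈×∉ {P = P} {Q} {i} i∈Q─P with P i | Q i
... | false | true = refl , refl

⊆⇒count≤ : ∀ {k} {P Q : Fin k → Bool} → P ⊆ Q → count P ≤ count Q
⊆⇒count≤ P⊆Q = injection⇒count≤ (λ i → i) P⊆Q (λ _ _ _ _ i≡j → i≡j)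

count≥1 : ∀ {k} {R : Fin k → Bool} {x} → R x ≡ true → 1 ≤ count R
count≥1 {R = R} {x} Rx rewrite count-─⁅⁆ R x Rx = s≤s z≤n

count≥2 : ∀ {k} {R : Fin k → Bool} {x y} → R x ≡ true → R y ≡ true → x ≢ y → 2 ≤ count R
count≥2 {R = R} {x} Rx Ry x≢y rewrite count-─⁅⁆ R x Rx =
  s≤s (count≥1 {R = R ─ ⁅ x ⁆} (∈-─⁅⁆ {Q = R} Ry (x≢y ∘ sym)))

count≤2 : ∀ {k} {R : Fin k → Bool} {x y} → (∀ i → R i ≡ true → i ≡ x ⊎ i ≡ y) → count R ≤ 2
count≤2 {k} {R} {x} {y} R⊆xy = injection⇒count≤ {Q = λ (_ : Fin 2) → true} side (λ _ _ → refl) inj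
  where
  side : Fin k → Fin 2
  side i = if ⁅ x ⁆ i then zero else suc zero
  other : ∀ {i} → R i ≡ true → i ≢ x → i ≡ y
  other Ri i≢x with R⊆xy _ Ri
  ... | inj₁ i≡x = contradiction i≡x i≢x
  ... | inj₂ i≡y = i≡y
  inj : InjectiveOn R side
  inj i j Ri Rj eq with i ≟ x | j ≟ x
  ... | yes i≡x | yes j≡x = trans i≡x (sym j≡x)
  ... | no  i≢x | no  j≢x = trans (other Ri i≢x) (sym (other Rj j≢x))
  ... | yes _   | no  _   = case eq of λ ()
  ... | no  _   | yes _   = case eq of λ ()

⊆∧count≥⇒⊇ : ∀ {k} {P Q : Fin k → Bool} → P ⊆ Q → count Q ≤ count P → Q ⊆ P
⊆∧count≥⇒⊇ {P = P} {Q} P⊆Q Q≤P i Qi with P i in Pi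
... | true  = refl
... | false = contradiction Q≤P (ℕ.<⇒≱ (begin-strict
  count P                 <⟨ ℕ.m<m+n (count P) (count≥1 {R = Q ─ P} (∈-─ {P = P} {Q} Qi Pi)) ⟩
  count P + count (Q ─ P) ≡⟨ count-─ P⊆Q ⟨
  count Q                 ∎))
  where open ℕ.≤-Reasoning

-- Nonnegative sums

-- `_≈_` identifies the indices naming the same term of the sum `s`: sumVec indexes
-- its terms by functions, which can only be compared pointwise.
record IsNonnegSum {A : Set} (_≈_ : A → A → Set) (s : (A → ℤ) → ℤ) : Set where
  field
    sum-nonneg : ∀ h → (∀ a → 0ℤ ℤ.≤ h a) → 0ℤ ℤ.≤ s h
    term≤sum   : ∀ h a {c} → (∀ b → 0ℤ ℤ.≤ h b) → (∀ b → b ≈ a → c ℤ.≤ h b) → c ℤ.≤ s h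

open IsNonnegSum

sumBool-isNonnegSum : IsNonnegSum _≡_ sumBool
sumBool-isNonnegSum .sum-nonneg h h≥0 = +-mono-≤ (h≥0 false) (h≥0 true)
sumBool-isNonnegSum .term≤sum h false {c} h≥0 c≤h =
  subst (ℤ._≤ sumBool h) (+-identityʳ c) (+-mono-≤ (c≤h false refl) (h≥0 true))
sumBool-isNonnegSum .term≤sum h true  {c} h≥0 c≤h =
  subst (ℤ._≤ sumBool h) (+-identityˡ c) (+-mono-≤ (h≥0 false) (c≤h true refl))

sumVec-isNonnegSum : ∀ {A : Set} {_≈_ : A → A → Set} {s} k →
  IsNonnegSum _≈_ s → IsNonnegSum (Pointwise _≈_) (sumVec k s)
sumVec-isNonnegSum zero    s-sum .sum-nonneg h h≥0 = h≥0 _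
sumVec-isNonnegSum zero    s-sum .term≤sum h a h≥0 c≤h = c≤h _ (λ ())
sumVec-isNonnegSum (suc k) s-sum .sum-nonneg h h≥0 =
  s-sum .sum-nonneg _ λ a → sumVec-isNonnegSum k s-sum .sum-nonneg _ λ g → h≥0 (a ∷ g)
sumVec-isNonnegSum (suc k) s-sum .term≤sum h a h≥0 c≤h =
  s-sum .term≤sum _ (a zero) (λ b → sumVec-isNonnegSum k s-sum .sum-nonneg _ λ g → h≥0 (b ∷ g))
    λ b b≈a₀ → sumVec-isNonnegSum k s-sum .term≤sum _ (λ i → a (suc i)) (λ g → h≥0 (b ∷ g))
      λ g g≈a₊ → c≤h (b ∷ g) λ { zero → b≈a₀ ; (suc i) → g≈a₊ i }

sumVE-≥ : ∀ n (z : (Fin n → Bool) → (Fin n → Fin n → Bool) → ℤ) V₀ E₀ {c} →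
  (∀ V' E' → 0ℤ ℤ.≤ z V' E') →
  (∀ V' E' → V' ≗ V₀ → (∀ i → E' i ≗ E₀ i) → c ℤ.≤ z V' E') → c ℤ.≤ sumVE n z
sumVE-≥ n z V₀ E₀ z≥0 c≤z =
  sumV .term≤sum _ V₀ (λ V' → sumE .sum-nonneg _ (z≥0 V'))
    λ V' V'≗V₀ → sumE .term≤sum _ E₀ (z≥0 V') λ E' → c≤z V' E' V'≗V₀
  where
  sumV = sumVec-isNonnegSum n sumBool-isNonnegSum
  sumE = sumVec-isNonnegSum n sumV

1≤i⇒-i≢0 : ∀ {i} → 1ℤ ℤ.≤ i → - i ≢ 0ℤ
1≤i⇒-i≢0 (+≤+ (s≤s _)) ()

-- Graph isomorphism

Vert-≡ : ∀ {n} {G : Graph n} {x y : Vert G} → proj₁ x ≡ proj₁ y → x ≡ y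
Vert-≡ {x = i , p} {.i , q} refl = cong (i ,_) (Decidable⇒UIP.≡-irrelevant Bool._≟_ p q)

E-V₂ : ∀ {n} (G : Graph n) i j → E G i j ≡ true → V G j ≡ true
E-V₂ G i j e = E-V G j i (trans (E-sym G j i) e)

≗⇒≅ : ∀ {n} {G K : Graph n} → (∀ i → V G i ≡ V K i) → (∀ i j → E G i j ≡ E K i j) → G ≅ K
≗⇒≅ V≗ E≗ = record
  { to      = λ (i , p) → i , trans (sym (V≗ i)) p
  ; from    = λ (i , p) → i , trans (V≗ i) p
  ; from-to = λ _ → refl
  ; to-from = λ _ → refl
  ; adj     = λ (i , _) (j , _) → E≗ i j
  }

≅-refl : ∀ {n} {G : Graph n} → G ≅ G
≅-refl = ≗⇒≅ (λ _ → refl) (λ _ _ → refl)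

mkGraph-≅ : ∀ {n} {V' : Fin n → Bool} {E'} {s s' v v'} → mkGraph V' E' s v ≅ mkGraph V' E' s' v'
mkGraph-≅ = ≗⇒≅ (λ _ → refl) (λ _ _ → refl)

≅-sym : ∀ {n m} {G : Graph n} {K : Graph m} → G ≅ K → K ≅ G
≅-sym {K = K} G≅K = record
  { to      = from
  ; from    = to
  ; from-to = to-from
  ; to-from = from-to
  ; adj     = λ x y → sym (trans (adj (from x) (from y)) (cong₂ (E K) (to-from x) (to-from y)))
  }
  where open _≅_ G≅K

≅-trans : ∀ {n m k} {G : Graph n} {K : Graph m} {L : Graph k} → G ≅ K → K ≅ L → G ≅ L
≅-trans {K = K} G≅K K≅L = record
  { to      = K→L.to ∘ G→K.to
  ; from    = G→K.from ∘ K→L.from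
  ; from-to = λ x → trans (cong (proj₁ ∘ G→K.from) (Vert-≡ {G = K} (K→L.from-to (G→K.to x)))) (G→K.from-to x)
  ; to-from = λ y → trans (cong (proj₁ ∘ K→L.to) (Vert-≡ {G = K} (G→K.to-from (K→L.from y)))) (K→L.to-from y)
  ; adj     = λ x y → trans (G→K.adj x y) (K→L.adj (G→K.to x) (G→K.to y))
  }
  where
  module G→K = _≅_ G≅K
  module K→L = _≅_ K≅L

module _ {n m} {G : Graph n} {K : Graph m} (G≅K : G ≅ K) where
  open _≅_ G≅K

  walk-from : ∀ {a b} (a∈K : V K a ≡ true) (b∈K : V K b ≡ true) → Walk K a b →
              Walk G (proj₁ (from (a , a∈K))) (proj₁ (from (b , b∈K)))
  walk-from a∈K b∈K here =
    subst (λ y → Walk G (proj₁ (from (_ , a∈K))) (proj₁ (from y))) (Vert-≡ {G = K} refl) here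
  walk-from {a} a∈K b∈K (step {j = c} ac w) = step ac′ (walk-from c∈K b∈K w)
    where
    c∈K = E-V₂ K a c ac
    ac′ = trans (adj (from (a , a∈K)) (from (c , c∈K))) (trans (cong₂ (E K) (to-from _) (to-from _)) ac)

  Connected-≅ : Connected K → Connected G
  Connected-≅ ((k , k∈K) , walks) = from (k , k∈K) , λ i j i∈G j∈G →
    subst₂ (Walk G) (from-to (i , i∈G)) (from-to (j , j∈G))
      (walk-from (to∈K i∈G) (to∈K j∈G) (walks _ _ (to∈K i∈G) (to∈K j∈G)))
    where
    to∈K : ∀ {i} (i∈G : V G i ≡ true) → V K (proj₁ (to (i , i∈G))) ≡ true
    to∈K {i} i∈G = proj₂ (to (i , i∈G))

module _ {n} {G K : Graph n} (f : Vert G → Vert K) where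
  private
    extend : ∀ i {b} → V G i ≡ b → Fin n
    extend i {true}  i∈G = proj₁ (f (i , i∈G))
    extend i {false} _   = i

    extend-≡ : ∀ i {b} (e : V G i ≡ b) (i∈G : V G i ≡ true) → extend i e ≡ proj₁ (f (i , i∈G))
    extend-≡ i {true}  e i∈G = cong (λ p → proj₁ (f (i , p))) (Decidable⇒UIP.≡-irrelevant Bool._≟_ e i∈G)
    extend-≡ i {false} e i∈G = contradiction (trans (sym e) i∈G) λ ()

  onFin : Fin n → Fin n
  onFin i = extend i refl

  onFin-≡ : ∀ {i} (i∈G : V G i ≡ true) → onFin i ≡ proj₁ (f (i , i∈G))
  onFin-≡ {i} = extend-≡ i refl

module _ {n} {G K : Graph n} (G≅K : G ≅ K) where
  open _≅_ G≅K

  vertexMap : Fin n → Fin n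
  vertexMap = onFin {G = G} {K} to

  vertexMap-to : ∀ {i} (i∈G : V G i ≡ true) → vertexMap i ≡ proj₁ (to (i , i∈G))
  vertexMap-to = onFin-≡ {G = G} {K} to

  vertexMap-V : ∀ i → V G i ≡ true → V K (vertexMap i) ≡ true
  vertexMap-V i i∈G rewrite vertexMap-to i∈G = proj₂ (to (i , i∈G))

  vertexMap-injective : InjectiveOn (V G) vertexMap
  vertexMap-injective i j i∈G j∈G eq = begin
    i                               ≡⟨ from-to (i , i∈G) ⟨
    proj₁ (from (to (i , i∈G)))     ≡⟨ cong (proj₁ ∘ from) (Vert-≡ {G = K} to-eq) ⟩
    proj₁ (from (to (j , j∈G)))     ≡⟨ from-to (j , j∈G) ⟩
    j                               ∎
    where
    open ≡-Reasoning
    to-eq = trans (sym (vertexMap-to i∈G)) (trans eq (vertexMap-to j∈G))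

  vertexMap-E : ∀ i j → V G i ≡ true → V G j ≡ true → E G i j ≡ E K (vertexMap i) (vertexMap j)
  vertexMap-E i j i∈G j∈G rewrite vertexMap-to i∈G | vertexMap-to j∈G = adj (i , i∈G) (j , j∈G)

vertexMap-inverseˡ : ∀ {n} {G K : Graph n} (G≅K : G ≅ K) i → V G i ≡ true →
                     vertexMap (≅-sym G≅K) (vertexMap G≅K i) ≡ i
vertexMap-inverseˡ G≅K i i∈G rewrite vertexMap-to G≅K i∈G =
  trans (vertexMap-to (≅-sym G≅K) (proj₂ (to (i , i∈G)))) (from-to (i , i∈G))
  where open _≅_ G≅K

anyVector? : ∀ k {m} {P : (Fin k → Fin m) → Set} →
  (∀ {f g} → f ≗ g → P f → P g) → (∀ f → Dec (P f)) → Dec (∃ P)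
anyVector? zero    resp P? = map′ (_ ,_) (λ (f , p) → resp (λ ()) p) (P? (λ ()))
anyVector? (suc k) resp P? =
  map′ (λ (a , g , p) → a ∷ g , p) (λ (f , p) → f zero , f ∘ suc , resp head∷tail p)
    (any? λ a → anyVector? k (λ f≗g → resp (∷-cong a f≗g)) (P? ∘ (a ∷_)))
  where
  head∷tail : ∀ {f : Fin (suc k) → Fin _} → f ≗ (f zero ∷ f ∘ suc)
  head∷tail zero    = refl
  head∷tail (suc i) = refl
  ∷-cong : ∀ a {f g : Fin k → Fin _} → f ≗ g → (a ∷ f) ≗ (a ∷ g)
  ∷-cong a f≗g zero    = refl
  ∷-cong a f≗g (suc i) = f≗g i

module _ {n m} (G : Graph n) (K : Graph m) where
  IsoMaps : (Fin n → Fin m) → (Fin m → Fin n) → Set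
  IsoMaps f g =
    (∀ i → V G i ≡ true → V K (f i) ≡ true) ×
    (∀ j → V K j ≡ true → V G (g j) ≡ true) ×
    (∀ i → V G i ≡ true → g (f i) ≡ i) ×
    (∀ j → V K j ≡ true → f (g j) ≡ j) ×
    (∀ i j → V G i ≡ true → V G j ≡ true → E G i j ≡ E K (f i) (f j))

  isoMaps? : ∀ f g → Dec (IsoMaps f g)
  isoMaps? f g =
    all? (λ i → (V G i Bool.≟ true) →-dec (V K (f i) Bool.≟ true)) ×-dec
    all? (λ j → (V K j Bool.≟ true) →-dec (V G (g j) Bool.≟ true)) ×-dec
    all? (λ i → (V G i Bool.≟ true) →-dec (g (f i) ≟ i)) ×-dec
    all? (λ j → (V K j Bool.≟ true) →-dec (f (g j) ≟ j)) ×-dec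
    all? (λ i → all? λ j → (V G i Bool.≟ true) →-dec ((V G j Bool.≟ true) →-dec
      (E G i j Bool.≟ E K (f i) (f j))))

  IsoMaps-resp : ∀ {f f' g g'} → f ≗ f' → g ≗ g' → IsoMaps f g → IsoMaps f' g'
  IsoMaps-resp {f} {f'} {g} {g'} f≗f' g≗g' (f-V , g-V , gf , fg , f-E) =
    (λ i i∈G → subst (λ j → V K j ≡ true) (f≗f' i) (f-V i i∈G)) ,
    (λ j j∈K → subst (λ i → V G i ≡ true) (g≗g' j) (g-V j j∈K)) ,
    (λ i i∈G → trans (sym (trans (cong g (f≗f' i)) (g≗g' (f' i)))) (gf i i∈G)) ,
    (λ j j∈K → trans (sym (trans (cong f (g≗g' j)) (f≗f' (g' j)))) (fg j j∈K)) ,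
    (λ i j i∈G j∈G → trans (f-E i j i∈G j∈G) (cong₂ (E K) (f≗f' i) (f≗f' j)))

  IsoMaps⇒≅ : ∀ {f g} → IsoMaps f g → G ≅ K
  IsoMaps⇒≅ {f} {g} (f-V , g-V , gf , fg , f-E) = record
    { to      = λ (i , i∈G) → f i , f-V i i∈G
    ; from    = λ (j , j∈K) → g j , g-V j j∈K
    ; from-to = λ (i , i∈G) → gf i i∈G
    ; to-from = λ (j , j∈K) → fg j j∈K
    ; adj     = λ (i , i∈G) (j , j∈G) → f-E i j i∈G j∈G
    }

≅⇒IsoMaps : ∀ {n} {G K : Graph n} (G≅K : G ≅ K) → IsoMaps G K (vertexMap G≅K) (vertexMap (≅-sym G≅K))
≅⇒IsoMaps G≅K = vertexMap-V G≅K , vertexMap-V (≅-sym G≅K) ,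
  vertexMap-inverseˡ G≅K , vertexMap-inverseˡ (≅-sym G≅K) , vertexMap-E G≅K

_≅?_ : ∀ {n} (G K : Graph n) → Dec (G ≅ K)
_≅?_ {n} G K =
  map′ (λ (f , g , maps) → IsoMaps⇒≅ G K maps)
       (λ G≅K → vertexMap G≅K , vertexMap (≅-sym G≅K) , ≅⇒IsoMaps G≅K)
       (anyVector? n (λ f≗f' (g , maps) → g , IsoMaps-resp G K f≗f' (λ _ → refl) maps)
         λ f → anyVector? n (IsoMaps-resp G K (λ _ → refl)) (isoMaps? G K f))

-- Counting vertices and edges

module _ (n : ℕ) where
  source target : Fin (n * n) → Fin n
  source = proj₁ ∘ remQuot {n} n
  target = proj₂ ∘ remQuot {n} n

  source-combine : ∀ i j → source (combine i j) ≡ i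
  source-combine i j = cong proj₁ (remQuot-combine {n} {n} i j)

  target-combine : ∀ i j → target (combine i j) ≡ j
  target-combine i j = cong proj₂ (remQuot-combine {n} {n} i j)

  combine-source-target : ∀ x → combine (source x) (target x) ≡ x
  combine-source-target = combine-remQuot {n} n

-- A non-loop edge {i , j} is counted twice, as combine i j and as combine j i.
edgeSet : ∀ {n} → Graph n → Fin (n * n) → Bool
edgeSet {n} G x = E G (source n x) (target n x)

edgeSet-combine : ∀ {n} (G : Graph n) i j → edgeSet G (combine i j) ≡ E G i j
edgeSet-combine {n} G i j = cong₂ (E G) (source-combine n i j) (target-combine n i j)

module _ {n : ℕ} where
  _⊆ᴱ_ : Graph n → Graph n → Set
  G ⊆ᴱ K = ∀ i j → E G i j ≡ true → E K i j ≡ true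

  ⊆ᴱ⇒edgeSet⊆ : ∀ {G K} → G ⊆ᴱ K → edgeSet G ⊆ edgeSet K
  ⊆ᴱ⇒edgeSet⊆ G⊆K x = G⊆K (source n x) (target n x)

  edgeSet⊆⇒⊆ᴱ : ∀ {G K} → edgeSet G ⊆ edgeSet K → G ⊆ᴱ K
  edgeSet⊆⇒⊆ᴱ {G} {K} G⊆K i j ij∈G =
    trans (sym (edgeSet-combine K i j)) (G⊆K (combine i j) (trans (edgeSet-combine G i j) ij∈G))

  ⊆-antisym-≅ : ∀ {G K} → V G ⊆ V K → V K ⊆ V G → G ⊆ᴱ K → K ⊆ᴱ G → G ≅ K
  ⊆-antisym-≅ V-G⊆K V-K⊆G G⊆K K⊆G =
    ≗⇒≅ (λ i → Bool.⇔→≡ (mk⇔ (V-G⊆K i) (V-K⊆G i))) (λ i j → Bool.⇔→≡ (mk⇔ (G⊆K i j) (K⊆G i j)))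

module _ {n} {G K : Graph n} (G≅K : G ≅ K) where
  ≅⇒count-V≤ : count (V G) ≤ count (V K)
  ≅⇒count-V≤ = injection⇒count≤ (vertexMap G≅K) (vertexMap-V G≅K) (vertexMap-injective G≅K)

  ≅⇒count-E≤ : count (edgeSet G) ≤ count (edgeSet K)
  ≅⇒count-E≤ = injection⇒count≤ edgeMap edgeMap-E edgeMap-injective
    where
    φ = vertexMap G≅K

    edgeMap : Fin (n * n) → Fin (n * n)
    edgeMap x = combine (φ (source n x)) (φ (target n x))

    edgeMap-E : ∀ x → edgeSet G x ≡ true → edgeSet K (edgeMap x) ≡ true
    edgeMap-E x x∈G = begin
      edgeSet K (edgeMap x)                  ≡⟨ edgeSet-combine K _ _ ⟩
      E K (φ (source n x)) (φ (target n x))  ≡⟨ vertexMap-E G≅K _ _ (E-V G _ _ x∈G) (E-V₂ G _ _ x∈G) ⟨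
      edgeSet G x                            ≡⟨ x∈G ⟩
      true                                   ∎
      where open ≡-Reasoning

    edgeMap-injective : InjectiveOn (edgeSet G) edgeMap
    edgeMap-injective x y x∈G y∈G eq = begin
      x                                  ≡⟨ combine-source-target n x ⟨
      combine (source n x) (target n x)  ≡⟨ cong₂ combine source-eq target-eq ⟩
      combine (source n y) (target n y)  ≡⟨ combine-source-target n y ⟩
      y                                  ∎
      where
      open ≡-Reasoning
      φ-eqs = combine-injective _ _ _ _ eq
      source-eq = vertexMap-injective G≅K _ _ (E-V G _ _ x∈G) (E-V G _ _ y∈G) (proj₁ φ-eqs)
      target-eq = vertexMap-injective G≅K _ _ (E-V₂ G _ _ x∈G) (E-V₂ G _ _ y∈G) (proj₂ φ-eqs)

-- Members of Sub(H) and their weights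

InSub-refl : ∀ {n} {G : Graph n} → Connected G → InSub G G
InSub-refl G-conn = record
  { V-sub = λ _ p → p ; E-sub = λ _ _ e → e ; loop-h = λ _ _ l → l ; conn = G-conn }

ProperSub-≗ : ∀ {n} {H : Graph n} {V₀ E₀ V' E'} → ProperSub H V₀ E₀ →
  V' ≗ V₀ → (∀ i → E' i ≗ E₀ i) → ProperSub H V' E'
ProperSub-≗ {H = H} {V₀} {E₀} {V'} {E'} p₀ V≗ E≗ = record
  { sym'   = E'-sym
  ; EV'    = E'-V
  ; insub  = record
    { V-sub  = λ i i∈G → V-sub i (trans (sym (V≗ i)) i∈G)
    ; E-sub  = λ i j ij∈G → E-sub i j (trans (sym (E≗ i j)) ij∈G)
    ; loop-h = λ i i∈G ii∈H → trans (E≗ i i) (loop-h i (trans (sym (V≗ i)) i∈G) ii∈H)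
    ; conn   = Connected-≅ G≅G₀ conn
    }
  ; not≅H  = λ G≅H → not≅H (≅-trans (≅-sym G≅G₀) G≅H)
  }
  where
  open ProperSub p₀
  open InSub insub
  E'-sym : ∀ i j → E' i j ≡ E' j i
  E'-sym i j = trans (E≗ i j) (trans (sym' i j) (sym (E≗ j i)))
  E'-V : ∀ i j → E' i j ≡ true → V' i ≡ true
  E'-V i j ij∈G = trans (V≗ i) (EV' i j (trans (sym (E≗ i j)) ij∈G))
  G≅G₀ : mkGraph V' E' E'-sym E'-V ≅ asGraph p₀
  G≅G₀ = ≗⇒≅ V≗ E≗

Lam-≅ : ∀ {n m} {J : Graph m} {G : Graph n} {c} → Connected G → J ≅ G → Lam J G c → c ≡ 1ℤ
Lam-≅ G-conn J≅G (lam-zero no-copy)    = contradiction (_ , InSub-refl G-conn , ≅-sym J≅G) no-copy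
Lam-≅ G-conn J≅G (lam-one _)           = refl
Lam-≅ G-conn J≅G (lam-rec _ J≇G _ _ _) = contradiction J≅G J≇G

Lam-nonneg : ∀ {n m} {J : Graph m} {G : Graph n} {c} →
  (∀ G' → InSub G G' → G' ≅ J → J ≅ G) → Lam J G c → 0ℤ ℤ.≤ c
Lam-nonneg copy⇒≅ (lam-zero _) = +≤+ z≤n
Lam-nonneg copy⇒≅ (lam-one _)  = +≤+ z≤n
Lam-nonneg copy⇒≅ (lam-rec (G' , G'⊆G , G'≅J) J≇G _ _ _) = contradiction (copy⇒≅ G' G'⊆G G'≅J) J≇G

Copy : ∀ {n m} → Graph n → Graph m → (Fin n → Bool) → (Fin n → Fin n → Bool) → Set
Copy H J V' E' = Σ (ProperSub H V' E') λ p → asGraph p ≅ J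

copy? : ∀ {n} {H J : Graph n} → Connected J → ¬ J ≅ H → ∀ V' E' → Dec (Copy H J V' E')
copy? {n} {H} {J} J-conn J≇H V' E'
  with all? (λ i → all? λ j → E' i j Bool.≟ E' j i)
     | all? (λ i → all? λ j → (E' i j Bool.≟ true) →-dec (V' i Bool.≟ true))
... | no ¬E'-sym | _         = no λ (p , _) → ¬E'-sym (ProperSub.sym' p)
... | yes _      | no ¬E'-V  = no λ (p , _) → ¬E'-V (ProperSub.EV' p)
... | yes E'-sym | yes E'-V  = map′ toCopy fromCopy (subgraph? ×-dec (G ≅? J))
  where
  G = mkGraph V' E' E'-sym E'-V
  Subgraph : Set
  Subgraph = (∀ i → V' i ≡ true → V H i ≡ true) ×
             (∀ i j → E' i j ≡ true → E H i j ≡ true) ×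
             (∀ i → V' i ≡ true → E H i i ≡ true → E' i i ≡ true)
  subgraph? : Dec Subgraph
  subgraph? =
    all? (λ i → (V' i Bool.≟ true) →-dec (V H i Bool.≟ true)) ×-dec
    all? (λ i → all? λ j → (E' i j Bool.≟ true) →-dec (E H i j Bool.≟ true)) ×-dec
    all? (λ i → (V' i Bool.≟ true) →-dec ((E H i i Bool.≟ true) →-dec (E' i i Bool.≟ true)))
  toCopy : Subgraph × G ≅ J → Copy H J V' E'
  toCopy ((V-sub , E-sub , loop-h) , G≅J) = record
    { sym'  = E'-sym
    ; EV'   = E'-V
    ; insub = record { V-sub = V-sub ; E-sub = E-sub ; loop-h = loop-h ; conn = Connected-≅ G≅J J-conn }
    ; not≅H = λ G≅H → J≇H (≅-trans (≅-sym G≅J) G≅H)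
    } , G≅J
  fromCopy : Copy H J V' E' → Subgraph × G ≅ J
  fromCopy (p , p≅J) = (V-sub , E-sub , loop-h) , ≅-trans mkGraph-≅ p≅J
    where open InSub (ProperSub.insub p)

module EdgeDeletion {n} {H H⁻ : Graph n} {u v : Fin n} (u≢v : u ≢ v) (uv∈H : E H u v ≡ true)
                    (H⁻-deletes-uv : DeleteEdge H H⁻ u v) (H⁻-conn : Connected H⁻) where
  open DeleteEdge H⁻-deletes-uv

  IsUV : Fin n → Fin n → Set
  IsUV i j = (i ≡ u × j ≡ v) ⊎ (i ≡ v × j ≡ u)

  isUV? : ∀ i j → Dec (IsUV i j)
  isUV? i j = ((i ≟ u) ×-dec (j ≟ v)) ⊎-dec ((i ≟ v) ×-dec (j ≟ u))

  H⁻⊆ᴱH : H⁻ ⊆ᴱ H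
  H⁻⊆ᴱH i j ij∈H⁻ with isUV? i j
  ... | no ¬uv                   = trans (sym (kept i j ¬uv)) ij∈H⁻
  ... | yes (inj₁ (refl , refl)) = contradiction (trans (sym ij∈H⁻) gone) λ ()
  ... | yes (inj₂ (refl , refl)) = contradiction (trans (sym ij∈H⁻) (trans (E-sym H⁻ v u) gone)) λ ()

  only-uv-deleted : ∀ i j → E H i j ≡ true → E H⁻ i j ≡ false → IsUV i j
  only-uv-deleted i j ij∈H ij∉H⁻ with isUV? i j
  ... | yes uv  = uv
  ... | no ¬uv = contradiction (trans (sym ij∉H⁻) (trans (kept i j ¬uv) ij∈H)) λ ()

  loops-kept : ∀ i → E H⁻ i i ≡ E H i i
  loops-kept i = kept i i λ { (inj₁ (i≡u , i≡v)) → u≢v (trans (sym i≡u) i≡v)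
                           ; (inj₂ (i≡v , i≡u)) → u≢v (trans (sym i≡u) i≡v) }

  H⁻∈Sub : InSub H H⁻
  H⁻∈Sub = record
    { V-sub  = λ i i∈H⁻ → trans (sym (same-V i)) i∈H⁻
    ; E-sub  = H⁻⊆ᴱH
    ; loop-h = λ i _ ii∈H → trans (loops-kept i) ii∈H
    ; conn   = H⁻-conn
    }

  H⁻≇H : ¬ H⁻ ≅ H
  H⁻≇H H⁻≅H = contradiction (trans (sym uv∉H⁻) (H⊆H⁻ (combine u v) uv∈H′)) λ ()
    where
    H⊆H⁻ = ⊆∧count≥⇒⊇ (⊆ᴱ⇒edgeSet⊆ {G = H⁻} {H} H⁻⊆ᴱH) (≅⇒count-E≤ (≅-sym H⁻≅H))
    uv∈H′ = trans (edgeSet-combine H u v) uv∈H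
    uv∉H⁻ = trans (edgeSet-combine H⁻ u v) gone

  count-E≤count-E⁻+2 : count (edgeSet H) ≤ count (edgeSet H⁻) + 2
  count-E≤count-E⁻+2 = begin
    count (edgeSet H)                                    ≡⟨ count-─ (⊆ᴱ⇒edgeSet⊆ {G = H⁻} {H} H⁻⊆ᴱH) ⟩
    count (edgeSet H⁻) + count (edgeSet H ─ edgeSet H⁻)  ≤⟨ ℕ.+-monoʳ-≤ (count (edgeSet H⁻)) (count≤2 only-uv) ⟩
    count (edgeSet H⁻) + 2                               ∎
    where
    open ℕ.≤-Reasoning
    pair≡ : ∀ {x i j} → source n x ≡ i → target n x ≡ j → x ≡ combine i j
    pair≡ {x} s≡i t≡j = trans (sym (combine-source-target n x)) (cong₂ combine s≡i t≡j)
    only-uv : ∀ x → (edgeSet H ─ edgeSet H⁻) x ≡ true → x ≡ combine u v ⊎ x ≡ combine v u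
    only-uv x x∈H─H⁻ with ∈-─⇒∈×∉ {P = edgeSet H⁻} {edgeSet H} x∈H─H⁻
    ... | x∈H , x∉H⁻ with only-uv-deleted _ _ x∈H x∉H⁻
    ... | inj₁ (s≡u , t≡v) = inj₁ (pair≡ s≡u t≡v)
    ... | inj₂ (s≡v , t≡u) = inj₂ (pair≡ s≡v t≡u)

  copy-spans : ∀ {G'} → V G' ⊆ V H → G' ≅ H⁻ → V H ⊆ V G'
  copy-spans {G'} G'⊆H G'≅H⁻ = ⊆∧count≥⇒⊇ G'⊆H (begin
    count (V H)   ≤⟨ ⊆⇒count≤ (λ i i∈H → trans (same-V i) i∈H) ⟩
    count (V H⁻)  ≤⟨ ≅⇒count-V≤ (≅-sym G'≅H⁻) ⟩
    count (V G')  ∎)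
    where open ℕ.≤-Reasoning

  copy+edge⇒⊇ᴱH : ∀ {G G'} → G ⊆ᴱ H → G' ⊆ᴱ G → G' ≅ H⁻ →
    ∀ {i j} → i ≢ j → E G i j ≡ true → E G' i j ≡ false → H ⊆ᴱ G
  copy+edge⇒⊇ᴱH {G} {G'} G⊆H G'⊆G G'≅H⁻ {i} {j} i≢j ij∈G ij∉G' =
    edgeSet⊆⇒⊆ᴱ {G = H} {G} (⊆∧count≥⇒⊇ (⊆ᴱ⇒edgeSet⊆ {G = G} {H} G⊆H) (begin
      count (edgeSet H)                                   ≤⟨ count-E≤count-E⁻+2 ⟩
      count (edgeSet H⁻) + 2                              ≤⟨ ℕ.+-monoˡ-≤ 2 (≅⇒count-E≤ (≅-sym G'≅H⁻)) ⟩
      count (edgeSet G') + 2                              ≤⟨ ℕ.+-monoʳ-≤ _ (count≥2 (new i j ij∈G ij∉G') (new j i ji∈G ji∉G') ij≢ji) ⟩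
      count (edgeSet G') + count (edgeSet G ─ edgeSet G') ≡⟨ count-─ (⊆ᴱ⇒edgeSet⊆ {G = G'} {G} G'⊆G) ⟨
      count (edgeSet G)                                   ∎))
    where
    open ℕ.≤-Reasoning
    new : ∀ a b → E G a b ≡ true → E G' a b ≡ false → (edgeSet G ─ edgeSet G') (combine a b) ≡ true
    new a b ab∈G ab∉G' = ∈-─ {P = edgeSet G'} {edgeSet G}
      (trans (edgeSet-combine G a b) ab∈G) (trans (edgeSet-combine G' a b) ab∉G')
    ji∈G  = trans (E-sym G j i) ij∈G
    ji∉G' = trans (E-sym G' j i) ij∉G'
    ij≢ji : combine i j ≢ combine j i
    ij≢ji = i≢j ∘ proj₁ ∘ combine-injective i j j i

  copy⇒≅H⁻ : ∀ {G G'} → InSub H G → ¬ G ≅ H → InSub G G' → G' ≅ H⁻ → G ≅ H⁻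
  copy⇒≅H⁻ {G} {G'} G⊆H G≇H G'⊆G G'≅H⁻ =
    ≅-trans (⊆-antisym-≅ (λ i → H⊆G' i ∘ G⊆H.V-sub i) G'⊆G.V-sub G⊆ᴱG' G'⊆G.E-sub) G'≅H⁻
    where
    module G⊆H = InSub G⊆H
    module G'⊆G = InSub G'⊆G
    H⊆G' : V H ⊆ V G'
    H⊆G' = copy-spans (λ i → G⊆H.V-sub i ∘ G'⊆G.V-sub i) G'≅H⁻
    G⊆ᴱG' : G ⊆ᴱ G'
    G⊆ᴱG' i j ij∈G with E G' i j in G'ij | i ≟ j
    ... | true  | _        = refl
    ... | false | yes refl =
      contradiction (trans (sym G'ij) (G'⊆G.loop-h i (H⊆G' i (G⊆H.V-sub i (E-V G i i ij∈G))) ij∈G)) λ ()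
    ... | false | no i≢j   =
      contradiction (⊆-antisym-≅ G⊆H.V-sub (λ i → G'⊆G.V-sub i ∘ H⊆G' i) G⊆H.E-sub
                      (copy+edge⇒⊇ᴱH {G = G} G⊆H.E-sub G'⊆G.E-sub G'≅H⁻ i≢j ij∈G G'ij)) G≇H

  H⁻-proper : ProperSub H (V H⁻) (E H⁻)
  H⁻-proper = record { sym' = E-sym H⁻ ; EV' = E-V H⁻ ; insub = H⁻∈Sub ; not≅H = H⁻≇H }

  Lam-proper-nonneg : ∀ {V' E' c} (p : ProperSub H V' E') → Lam H⁻ (asGraph p) c → 0ℤ ℤ.≤ c
  Lam-proper-nonneg p = Lam-nonneg λ G' G'⊆p G'≅H⁻ →
    ≅-sym (copy⇒≅H⁻ (ProperSub.insub p) (ProperSub.not≅H p) G'⊆p G'≅H⁻)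

  copyWeight : (Fin n → Bool) → (Fin n → Fin n → Bool) → ℤ
  copyWeight V' E' = if does (copy? H⁻-conn H⁻≇H V' E') then 1ℤ else 0ℤ

  Lam-copyWeight : ∀ V' E' (p : ProperSub H V' E') → Lam H⁻ (asGraph p) (copyWeight V' E')
  Lam-copyWeight V' E' p with copy? H⁻-conn H⁻≇H V' E'
  ... | yes (p' , p'≅H⁻) = lam-one (≅-sym (≅-trans mkGraph-≅ p'≅H⁻))
  ... | no ¬copy         = lam-zero λ (G' , G'⊆p , G'≅H⁻) →
    ¬copy (p , copy⇒≅H⁻ (ProperSub.insub p) (ProperSub.not≅H p) G'⊆p G'≅H⁻)

  copyWeight-improper : ∀ V' E' → ¬ ProperSub H V' E' → copyWeight V' E' ≡ 0ℤ
  copyWeight-improper V' E' ¬p with copy? H⁻-conn H⁻≇H V' E'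
  ... | yes (p , _) = contradiction p ¬p
  ... | no _        = refl

  λ-exists : ∃ λ c → Lam H⁻ H c
  λ-exists = _ , lam-rec (H⁻ , H⁻∈Sub , ≅-refl) H⁻≇H copyWeight Lam-copyWeight copyWeight-improper

  weights-nonneg : ∀ (w : (Fin n → Bool) → (Fin n → Fin n → Bool) → ℤ) →
    (∀ V' E' (p : ProperSub H V' E') → Lam H⁻ (asGraph p) (w V' E')) →
    (∀ V' E' → ¬ ProperSub H V' E' → w V' E' ≡ 0ℤ) →
    ∀ V' E' → 0ℤ ℤ.≤ w V' E'
  -- Membership in Sub(H) is not decided here, so we decide the sign instead.
  weights-nonneg w w-Lam w-improper V' E' with 0ℤ ≤? w V' E'
  ... | yes 0≤w = 0≤w
  ... | no  0≰w = contradiction (≤-reflexive (sym (w-improper V' E' improper))) 0≰w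
    where
    improper : ¬ ProperSub H V' E'
    improper p = 0≰w (Lam-proper-nonneg p (w-Lam V' E' p))

  λ-nonzero : ∀ c → Lam H⁻ H c → c ≢ 0ℤ
  λ-nonzero _ (lam-zero no-copy) = contradiction (H⁻ , H⁻∈Sub , ≅-refl) no-copy
  λ-nonzero _ (lam-one H⁻≅H)     = contradiction H⁻≅H H⁻≇H
  λ-nonzero _ (lam-rec _ _ w w-Lam w-improper) =
    1≤i⇒-i≢0 (sumVE-≥ n w (V H⁻) (E H⁻) (weights-nonneg w w-Lam w-improper) H⁻-weight)
    where
    H⁻-weight : ∀ V' E' → V' ≗ V H⁻ → (∀ i → E' i ≗ E H⁻ i) → 1ℤ ℤ.≤ w V' E'
    H⁻-weight V' E' V≗ E≗ = ≤-reflexive (sym (Lam-≅ p-conn (≅-sym (≗⇒≅ V≗ E≗)) (w-Lam V' E' p)))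
      where
      p = ProperSub-≗ H⁻-proper V≗ E≗
      p-conn = InSub.conn (ProperSub.insub p)

lemma3p13 : ∀ {n} (H H⁻ : Graph n) (u v : Fin n) →
    Connected H → ¬ (u ≡ v) → E H u v ≡ true →
    DeleteEdge H H⁻ u v → Connected H⁻ →
    (∃ λ (c : ℤ) → Lam H⁻ H c) × (∀ c → Lam H⁻ H c → ¬ (c ≡ 0ℤ))
lemma3p13 H H⁻ u v _ u≢v uv∈H H⁻-deletes-uv H⁻-conn = λ-exists , λ-nonzero
  where open EdgeDeletion u≢v uv∈H H⁻-deletes-uv H⁻-conn
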